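{- Let $G=(A\cup B,E)$ be a bipartite graph with vertex set $V=A\cup B$, where every vertex $v\in V$ has a strict preference order $\succ_v$ over its neighbours, and let $w:V\to\mathbb{Q}_{\ge 0}$ be vertex weights. A matching $M$ of $G$ is popular if and only if there exists a vector $\mathbf{y}\in\mathbb{Q}^{V}$ with $\sum_{v\in V}\mathbf{y}_v=0$ such that $\mathbf{y}_u+\mathbf{y}_v\ge \mathsf{vote}^M(\{u,v\})$ for every edge $\{u,v\}\in E$, $\mathbf{y}_v\ge 0$ for every vertex $v$ unmatched by $M$, and $\mathbf{y}_v\ge -w(v)$ for every $v\in V$.
   Context: Every vertex prefers being matched to any neighbour over being unmatched. For a matching $M$ and $v\in V$, $M(v)$ denotes the partner of $v$ in $M$ ($M(v)=\square$ if $v$ is unmatched). For matchings $M,M'$, let $V^+(M,M')$ be the set of vertices $v$ with $M(v)\succ_v M'(v)$ (being matched beats being unmatched), and $\Delta_w(M,M')=\sum_{v\in V^+(M,M')}w(v)-\sum_{v\in V^+(M',M)}w(v)$. A matching $M$ is popular if $\Delta_w(M,M')\ge 0$ for every matching $M'$. For $u\in V$ and a neighbour $v$ of $u$: $\mathsf{vote}^M_u(v)=0$ if $\{u,v\}\in M$; $\mathsf{vote}^M_u(v)=w(u)$ if $u$ is unmatched in $M$ or $v\succ_u M(u)$; and $\mathsf{vote}^M_u(v)=-w(u)$ otherwise. For an edge $\{u,v\}$, $\mathsf{vote}^M(\{u,v\})=\mathsf{vote}^M_u(v)+\mathsf{vote}^M_v(u)$. -}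

module Defs where

open import Data.Nat as ℕ using (ℕ; zero; suc)
open import Data.Fin as Fin using (Fin)
open import Data.Bool using (Bool; true; false; if_then_else_)
open import Data.Maybe using (Maybe; just; nothing)
open import Data.Rational using (ℚ; 0ℚ; _+_; -_; _≤_)
open import Data.Product using (_×_)
open import Relation.Nullary.Decidable using (⌊_⌋)
open import Relation.Binary.PropositionalEquality using (_≡_)

sumFin : {n : ℕ} → (Fin n → ℚ) → ℚ
sumFin {zero}  f = 0ℚ
sumFin {suc n} f = f Fin.zero + sumFin (λ i → f (Fin.suc i))

-- A finite bipartite graph G = (A ∪ B, E) with A = Fin nA, B = Fin nB,
-- strict preferences given by ranks (smaller rank = more preferred),
-- injective on the neighbourhood of each vertex, and weights w : V → ℚ≥0.
record BipInstance : Set where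
  field
    nA nB     : ℕ
    adj       : Fin nA → Fin nB → Bool
    rankA     : Fin nA → Fin nB → ℕ
    rankB     : Fin nB → Fin nA → ℕ
    rankA-inj : ∀ a b b′ → adj a b ≡ true → adj a b′ ≡ true →
                rankA a b ≡ rankA a b′ → b ≡ b′
    rankB-inj : ∀ b a a′ → adj a b ≡ true → adj a′ b ≡ true →
                rankB b a ≡ rankB b a′ → a ≡ a′
    wA        : Fin nA → ℚ
    wB        : Fin nB → ℚ
    wA-nonneg : ∀ a → 0ℚ ≤ wA a
    wB-nonneg : ∀ b → 0ℚ ≤ wB b

record Matching (I : BipInstance) : Set where
  open BipInstance I
  field
    mA     : Fin nA → Maybe (Fin nB)
    mB     : Fin nB → Maybe (Fin nA)
    mA-adj : ∀ a b → mA a ≡ just b → adj a b ≡ true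
    mA→mB  : ∀ a b → mA a ≡ just b → mB b ≡ just a
    mB→mA  : ∀ a b → mB b ≡ just a → mA a ≡ just b

-- prefers r x y : x ≻ y for a vertex with rank function r;
-- being matched beats being unmatched.
prefers : {n : ℕ} → (Fin n → ℕ) → Maybe (Fin n) → Maybe (Fin n) → Bool
prefers r (just x) nothing  = true
prefers r (just x) (just y) = ⌊ r x ℕ.<? r y ⌋
prefers r nothing  _        = false

contrib : ℚ → Bool → Bool → ℚ
contrib w true  _     = w
contrib w false true  = - w
contrib w false false = 0ℚ

module _ (I : BipInstance) where
  open BipInstance I
  open Matching

  -- Δ_w(M,M') = Σ_{v ∈ V⁺(M,M')} w(v) − Σ_{v ∈ V⁺(M',M)} w(v)
  Δw : Matching I → Matching I → ℚ
  Δw M M′ =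
    sumFin (λ a → contrib (wA a) (prefers (rankA a) (mA M a) (mA M′ a))
                                 (prefers (rankA a) (mA M′ a) (mA M a)))
    + sumFin (λ b → contrib (wB b) (prefers (rankB b) (mB M b) (mB M′ b))
                                   (prefers (rankB b) (mB M′ b) (mB M b)))

  Popular : Matching I → Set
  Popular M = ∀ (M′ : Matching I) → 0ℚ ≤ Δw M M′

  private
    isPartner : {n : ℕ} → Maybe (Fin n) → Fin n → Bool
    isPartner (just x) y = ⌊ x Fin.≟ y ⌋
    isPartner nothing  y = false

  voteA : Matching I → Fin nA → Fin nB → ℚ
  voteA M a b =
    if isPartner (mA M a) b then 0ℚ
    else (if prefers (rankA a) (just b) (mA M a) then wA a else - wA a)

  voteB : Matching I → Fin nB → Fin nA → ℚ
  voteB M b a =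
    if isPartner (mB M b) a then 0ℚ
    else (if prefers (rankB b) (just a) (mB M b) then wB b else - wB b)

  vote : Matching I → Fin nA → Fin nB → ℚ
  vote M a b = voteA M a b + voteB M b a

  DualFeasible : Matching I → (Fin nA → ℚ) → (Fin nB → ℚ) → Set
  DualFeasible M yA yB =
    (sumFin yA + sumFin yB ≡ 0ℚ)
    × (∀ a b → adj a b ≡ true → vote M a b ≤ yA a + yB b)
    × (∀ a → mA M a ≡ nothing → 0ℚ ≤ yA a)
    × (∀ b → mB M b ≡ nothing → 0ℚ ≤ yB b)
    × (∀ a → - wA a ≤ yA a)
    × (∀ b → - wB b ≤ yB b)

-- Weak duality gives one direction: since Σ y = 0, Δ_w(M, M′) regroups into one term per edge of M′ and one
-- per vertex of B that M′ leaves single, and each term is nonnegative by a dual constraint.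
-- Conversely, once yB is tied to yA along M, the dual constraints are difference constraints x v ≤ x u + q on
-- an exchange graph with node set A ∪ {0}; these are solvable as soon as no cycle has negative cost (eliminate
-- the nodes one at a time, Fourier–Motzkin style). A negative cycle can be taken simple, and switching M along
-- a simple cycle yields a matching M′ with Δ_w(M, M′) equal to the cost of the cycle, so popularity rules it out.
module Submission where

open import Defs
open import Algebra.Bundles using (CommutativeMonoid)
open import Data.Bool using (true; if_then_else_)
import Data.Bool.Properties as Bool
open import Data.Empty using (⊥-elim)
open import Data.Fin as Fin using (Fin; zero; suc)
open import Data.Fin.Properties using (punchInᵢ≢i)
open import Data.List using (List; []; _∷_; map; _∷ʳ_)
open import Data.List.Membership.Propositional using (_∈_; _∉_)
import Data.List.Membership.DecPropositional as DecMembership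
open import Data.List.Membership.Propositional.Properties using (∈-map⁺; ∈-map⁻)
open import Data.List.Relation.Binary.Permutation.Propositional using (_↭_; ↭-reflexive; ↭-sym; ↭-trans; ↭⇒↭ₛ)
open import Data.List.Relation.Binary.Permutation.Propositional.Properties using (drop-∷; ∷↭∷ʳ; ∈-resp-↭)
import Data.List.Relation.Binary.Permutation.Setoid.Properties as ↭ₛ
import Data.List.Relation.Unary.All as All
open import Data.List.Relation.Unary.All.Properties using (¬Any⇒All¬; All¬⇒¬Any)
open import Data.List.Relation.Unary.Any using (here; there)
open import Data.List.Relation.Unary.Unique.Propositional using (Unique; []; _∷_)
open import Data.Maybe using (Maybe; just; nothing; maybe; fromMaybe; _<∣>_)
open import Data.Maybe.Properties using (just-injective; ≡-dec)
open import Data.Nat as ℕ using (ℕ; zero; suc)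
import Data.Nat.Properties as ℕ
open import Data.Product using (Σ-syntax; _×_; _,_; proj₂)
open import Data.Rational using (ℚ; 0ℚ; _+_; -_; _-_; _≤_)
open import Data.Rational.Properties
open import Algebra.Properties.CommutativeMonoid.Sum +-0-commutativeMonoid
  using (sum; sum-cong-≗; sum-replicate-zero; sum-remove; ∑-comm; ∑-distrib-+)
open import Algebra.Properties.Group +-0-group using () renaming (⁻¹-involutive to neg-involutive)
open import Algebra.Properties.CommutativeSemigroup (CommutativeMonoid.commutativeSemigroup +-0-commutativeMonoid)
  using (interchange; x∙yz≈y∙xz)
open import Data.Rational.Solver using (module +-*-Solver)
open import Data.Sum using (_⊎_; inj₁; inj₂)
open import Function using (_∘_; case_of_)
open import Function.Bundles using (_⇔_; mk⇔)
open import Relation.Binary.PropositionalEquality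
open import Relation.Nullary using (¬_; Dec; yes; no)
open import Relation.Nullary.Decidable using (⌊_⌋; _×-dec_)
open import Relation.Unary using (_≐_)
open +-*-Solver

≤-translate : ∀ c {p q p′ q′} → p ≤ q → p + c ≡ p′ → q + c ≡ q′ → p′ ≤ q′
≤-translate c p≤q refl refl = +-monoˡ-≤ c p≤q

p≤p+q : ∀ p {q} → 0ℚ ≤ q → p ≤ p + q
p≤p+q p 0≤q = subst (_≤ p + _) (+-identityʳ p) (+-monoʳ-≤ p 0≤q)

+-nonneg : ∀ {p q} → 0ℚ ≤ p → 0ℚ ≤ q → 0ℚ ≤ p + q
+-nonneg {p} 0≤p 0≤q = ≤-trans 0≤p (p≤p+q p 0≤q)

0≤p+q⇒-q≤p : ∀ {p q} → 0ℚ ≤ p + q → - q ≤ p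
0≤p+q⇒-q≤p {p} {q} 0≤p+q =
  ≤-translate (- q) 0≤p+q (+-identityˡ (- q)) (solve 2 (λ p q → (p :+ q) :+ :- q := p) refl p q)

p≤r-s⇒s≤r-p : ∀ {p r s} → p ≤ r - s → s ≤ r - p
p≤r-s⇒s≤r-p {p} {r} {s} p≤r-s = ≤-translate (s - p) p≤r-s
  (solve 2 (λ p s → p :+ (s :- p) := s) refl p s) (solve 3 (λ r s p → (r :- s) :+ (s :- p) := r :- p) refl r s p)

sumFin≡sum : ∀ {n} (f : Fin n → ℚ) → sumFin f ≡ sum f
sumFin≡sum {zero}  f = refl
sumFin≡sum {suc n} f = cong (f zero +_) (sumFin≡sum (f ∘ suc))

sum-zero : ∀ {n} {f : Fin n → ℚ} → (∀ i → f i ≡ 0ℚ) → sum f ≡ 0ℚ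
sum-zero {n} f≗0 = trans (sum-cong-≗ f≗0) (sum-replicate-zero n)

sum-mono-≤ : ∀ {n} {f g : Fin n → ℚ} → (∀ i → f i ≤ g i) → sum f ≤ sum g
sum-mono-≤ {zero}  f≤g = ≤-refl
sum-mono-≤ {suc n} f≤g = +-mono-≤ (f≤g zero) (sum-mono-≤ (f≤g ∘ suc))

sum-nonneg : ∀ {n} {f : Fin n → ℚ} → (∀ i → 0ℚ ≤ f i) → 0ℚ ≤ sum f
sum-nonneg {n} {f} 0≤f = subst (_≤ sum f) (sum-replicate-zero n) (sum-mono-≤ 0≤f)

sum-update : ∀ {n} (f f′ : Fin n → ℚ) i → (∀ j → j ≢ i → f′ j ≡ f j) → f i ≡ 0ℚ →
             sum f′ ≡ f′ i + sum f
sum-update {suc n} f f′ i agree fi≡0 = begin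
  sum f′                 ≡⟨ sum-remove f′ ⟩
  f′ i + sum (f′ ∘ π)    ≡⟨ cong (f′ i +_) (sum-cong-≗ (λ j → agree (π j) (punchInᵢ≢i i j))) ⟩
  f′ i + sum (f ∘ π)     ≡⟨ cong (f′ i +_) sum-rest ⟩
  f′ i + sum f           ∎
  where
  open ≡-Reasoning
  π = Fin.punchIn i
  sum-rest : sum (f ∘ π) ≡ sum f
  sum-rest = begin
    sum (f ∘ π)          ≡⟨ +-identityˡ (sum (f ∘ π)) ⟨
    0ℚ + sum (f ∘ π)     ≡⟨ cong (_+ sum (f ∘ π)) fi≡0 ⟨
    f i + sum (f ∘ π)    ≡⟨ sum-remove f ⟨
    sum f                ∎

sum-single : ∀ {n} (f : Fin n → ℚ) i → (∀ j → j ≢ i → f j ≡ 0ℚ) → sum f ≡ f i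
sum-single {n} f i f≗0 = begin
  sum f                    ≡⟨ sum-update {n} (λ _ → 0ℚ) f i f≗0 refl ⟩
  f i + sum {n} (λ _ → 0ℚ) ≡⟨ cong (f i +_) (sum-replicate-zero n) ⟩
  f i + 0ℚ                 ≡⟨ +-identityʳ (f i) ⟩
  f i                      ∎
  where open ≡-Reasoning

-- Difference constraints and potentials

module _ {n : ℕ} (Arc : Fin n → Fin n → ℚ → Set) where

  infixr 5 _∷_

  data Walk : Fin n → Fin n → Set where
    []  : ∀ {i} → Walk i i
    _∷_ : ∀ {i j k q} → Arc i j q → Walk j k → Walk i k

  cost : ∀ {i j} → Walk i j → ℚ
  cost []                = 0ℚ
  cost (_∷_ {q = q} _ p) = q + cost p

  NoNegativeCycle : Set
  NoNegativeCycle = ∀ i (p : Walk i i) → 0ℚ ≤ cost p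

  Potential : Set
  Potential = Σ[ x ∈ (Fin n → ℚ) ] (∀ i j q → Arc i j q → x j ≤ x i + q)

  Step : Set
  Step = Σ[ u ∈ Fin n ] Σ[ v ∈ Fin n ] Σ[ q ∈ ℚ ] Arc u v q

-- Parallel arcs are allowed; eliminating a node only needs a cheapest arc between any two nodes, if any.
EmptyOrLeast : (ℚ → Set) → Set
EmptyOrLeast P = (∀ q → ¬ P q) ⊎ Σ[ q ∈ ℚ ] P q × (∀ r → P r → q ≤ r)

EmptyOrLeast-resp : ∀ {P Q : ℚ → Set} → P ≐ Q → EmptyOrLeast P → EmptyOrLeast Q
EmptyOrLeast-resp (P⊆Q , Q⊆P) (inj₁ ∅P)              = inj₁ (λ q → ∅P q ∘ Q⊆P)
EmptyOrLeast-resp (P⊆Q , Q⊆P) (inj₂ (q , Pq , least)) = inj₂ (q , P⊆Q Pq , λ r → least r ∘ Q⊆P)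

EmptyOrLeast-⊎ : ∀ {P Q : ℚ → Set} → EmptyOrLeast P → EmptyOrLeast Q → EmptyOrLeast (λ q → P q ⊎ Q q)
EmptyOrLeast-⊎ (inj₁ ∅P) (inj₁ ∅Q) = inj₁ λ { q (inj₁ Pq) → ∅P q Pq ; q (inj₂ Qq) → ∅Q q Qq }
EmptyOrLeast-⊎ (inj₁ ∅P) (inj₂ (q , Qq , least)) =
  inj₂ (q , inj₂ Qq , λ { r (inj₁ Pr) → ⊥-elim (∅P r Pr) ; r (inj₂ Qr) → least r Qr })
EmptyOrLeast-⊎ (inj₂ (p , Pp , least)) (inj₁ ∅Q) =
  inj₂ (p , inj₁ Pp , λ { r (inj₁ Pr) → least r Pr ; r (inj₂ Qr) → ⊥-elim (∅Q r Qr) })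
EmptyOrLeast-⊎ (inj₂ (p , Pp , leastP)) (inj₂ (q , Qq , leastQ)) with p ≤? q
... | yes p≤q =
  inj₂ (p , inj₁ Pp , λ { r (inj₁ Pr) → leastP r Pr ; r (inj₂ Qr) → ≤-trans p≤q (leastQ r Qr) })
... | no  p≰q =
  inj₂ (q , inj₂ Qq , λ { r (inj₁ Pr) → ≤-trans (<⇒≤ (≰⇒> p≰q)) (leastP r Pr) ; r (inj₂ Qr) → leastQ r Qr })

EmptyOrLeast-∃ : ∀ {n} {P : Fin n → ℚ → Set} → (∀ i → EmptyOrLeast (P i)) →
                 EmptyOrLeast (λ q → Σ[ i ∈ Fin n ] P i q)
EmptyOrLeast-∃ {zero}  _     = inj₁ λ { q (() , _) }
EmptyOrLeast-∃ {suc n} least =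
  EmptyOrLeast-resp
    ( (λ { (inj₁ Pq) → zero , Pq ; (inj₂ (i , Pq)) → suc i , Pq })
    , (λ { (zero , Pq) → inj₁ Pq ; (suc i , Pq) → inj₂ (i , Pq) }))
    (EmptyOrLeast-⊎ (least zero) (EmptyOrLeast-∃ (least ∘ suc)))

EmptyOrLeast-+ : ∀ {P Q : ℚ → Set} → EmptyOrLeast P → EmptyOrLeast Q →
                 EmptyOrLeast (λ q → Σ[ p₁ ∈ ℚ ] Σ[ p₂ ∈ ℚ ] P p₁ × Q p₂ × q ≡ p₁ + p₂)
EmptyOrLeast-+ (inj₁ ∅P) _         = inj₁ λ { q (p₁ , _ , Pp₁ , _) → ∅P p₁ Pp₁ }
EmptyOrLeast-+ (inj₂ _)  (inj₁ ∅Q) = inj₁ λ { q (_ , p₂ , _ , Qp₂ , _) → ∅Q p₂ Qp₂ }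
EmptyOrLeast-+ (inj₂ (p , Pp , leastP)) (inj₂ (q , Qq , leastQ)) =
  inj₂ (p + q , (p , q , Pp , Qq , refl) ,
        λ { r (r₁ , r₂ , Pr₁ , Qr₂ , refl) → +-mono-≤ (leastP r₁ Pr₁) (leastQ r₂ Qr₂) })

EmptyOrLeast-shift : ∀ {P : ℚ → Set} c → EmptyOrLeast P → EmptyOrLeast (λ q → Σ[ p ∈ ℚ ] P p × q ≡ c + p)
EmptyOrLeast-shift c (inj₁ ∅P)              = inj₁ λ { q (p , Pp , _) → ∅P p Pp }
EmptyOrLeast-shift c (inj₂ (p , Pp , least)) =
  inj₂ (c + p , (p , Pp , refl) , λ { r (r′ , Pr′ , refl) → +-monoʳ-≤ c (least r′ Pr′) })

EmptyOrLeast-if : ∀ {A : Set} → Dec A → ∀ q → EmptyOrLeast (λ r → A × r ≡ q)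
EmptyOrLeast-if (yes a) q = inj₂ (q , (a , refl) , λ { r (_ , refl) → ≤-refl })
EmptyOrLeast-if (no ¬a) q = inj₁ λ { r (a , _) → ¬a a }

module Elimination {m : ℕ} (Arc : Fin (suc m) → Fin (suc m) → ℚ → Set) where

  Shortcut : Fin m → Fin m → ℚ → Set
  Shortcut i j q = Arc (suc i) (suc j) q
                 ⊎ Σ[ q₁ ∈ ℚ ] Σ[ q₂ ∈ ℚ ] Arc (suc i) zero q₁ × Arc zero (suc j) q₂ × q ≡ q₁ + q₂

  expand : ∀ {i j} → Walk Shortcut i j → Walk Arc (suc i) (suc j)
  expand []                                = []
  expand (inj₁ a ∷ p)                      = a ∷ expand p
  expand (inj₂ (_ , _ , a₁ , a₂ , _) ∷ p) = a₁ ∷ a₂ ∷ expand p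

  cost-expand : ∀ {i j} (p : Walk Shortcut i j) → cost Arc (expand p) ≡ cost Shortcut p
  cost-expand []                                   = refl
  cost-expand (_∷_ {q = q} (inj₁ _) p)             = cong (q +_) (cost-expand p)
  cost-expand (inj₂ (q₁ , q₂ , _ , _ , refl) ∷ p) =
    trans (cong (λ c → q₁ + (q₂ + c)) (cost-expand p)) (sym (+-assoc q₁ q₂ _))

  noNegativeCycle : NoNegativeCycle Arc → NoNegativeCycle Shortcut
  noNegativeCycle noNeg i p = subst (0ℚ ≤_) (cost-expand p) (noNeg (suc i) (expand p))

  emptyOrLeast : (∀ u v → EmptyOrLeast (Arc u v)) → ∀ i j → EmptyOrLeast (Shortcut i j)
  emptyOrLeast least i j =
    EmptyOrLeast-⊎ (least (suc i) (suc j)) (EmptyOrLeast-+ (least (suc i) zero) (least zero (suc j)))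

  -- x₀ has to lie between every x j − q₂ (arc zero → suc j) and every x i + q₁ (arc suc i → zero);
  -- the shortcut arcs of cost q₁ + q₂ are exactly what makes this interval nonempty.
  valueAtZero : (∀ u v → EmptyOrLeast (Arc u v)) → ((x , _) : Potential Shortcut) →
                Σ[ x₀ ∈ ℚ ] (∀ i q → Arc (suc i) zero q → x₀ ≤ x i + q)
                          × (∀ j q → Arc zero (suc j) q → x j ≤ x₀ + q)
  valueAtZero least (x , x-ok)
    with EmptyOrLeast-∃ (λ i → EmptyOrLeast-shift (x i) (least (suc i) zero))
  ... | inj₂ (_ , (i , q₁ , a₁ , refl) , leastIn) =
    x i + q₁ , (λ i′ q a → leastIn _ (i′ , q , a , refl))
             , (λ j q a → subst (x j ≤_) (sym (+-assoc (x i) q₁ q)) (x-ok i j _ (inj₂ (q₁ , q , a₁ , a , refl))))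
  ... | inj₁ noneIn
    with EmptyOrLeast-∃ (λ j → EmptyOrLeast-shift (- x j) (least zero (suc j)))
  ...   | inj₂ (v , (j , _ , _ , refl) , leastOut) =
    - v , (λ i q a → ⊥-elim (noneIn _ (i , q , a , refl)))
        , (λ j′ q a → subst (x j′ ≤_) (+-comm q (- v))
                        (p≤r-s⇒s≤r-p {v} {q} {x j′}
                          (subst (v ≤_) (+-comm (- x j′) q) (leastOut _ (j′ , q , a , refl)))))
  ...   | inj₁ noneOut =
    0ℚ , (λ i q a → ⊥-elim (noneIn _ (i , q , a , refl)))
       , (λ j q a → ⊥-elim (noneOut _ (j , q , a , refl)))

  extend : NoNegativeCycle Arc → (∀ u v → EmptyOrLeast (Arc u v)) → Potential Shortcut → Potential Arc
  extend noNeg least pot@(x , x-ok) with valueAtZero least pot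
  ... | x₀ , below , above = y , y-ok
    where
    y : Fin (suc m) → ℚ
    y zero    = x₀
    y (suc i) = x i

    y-ok : ∀ u v q → Arc u v q → y v ≤ y u + q
    y-ok zero    zero    q a = p≤p+q x₀ (subst (0ℚ ≤_) (+-identityʳ q) (noNeg zero (a ∷ [])))
    y-ok zero    (suc j) q a = above j q a
    y-ok (suc i) zero    q a = below i q a
    y-ok (suc i) (suc j) q a = x-ok i j q (inj₁ a)

potential : ∀ {n} (Arc : Fin n → Fin n → ℚ → Set) →
            (∀ u v → EmptyOrLeast (Arc u v)) → NoNegativeCycle Arc → Potential Arc
potential {zero}  Arc least noNeg = (λ ()) , λ ()
potential {suc m} Arc least noNeg =
  extend noNeg least (potential Shortcut (emptyOrLeast least) (noNegativeCycle noNeg))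
  where open Elimination Arc

-- Reduction to simple cycles

module _ {n : ℕ} {Arc : Fin n → Fin n → ℚ → Set} where
  open DecMembership (Fin._≟_ {n}) using (_∈?_)

  source target : Step Arc → Fin n
  source (u , _ , _ , _) = u
  target (_ , v , _ , _) = v

  label : Step Arc → ℚ
  label (_ , _ , q , _) = q

  steps : ∀ {i j} → Walk Arc i j → List (Step Arc)
  steps []                        = []
  steps (_∷_ {i} {j} {q = q} a p) = (i , j , q , a) ∷ steps p

  sources targets : ∀ {i j} → Walk Arc i j → List (Fin n)
  sources = map source ∘ steps
  targets = map target ∘ steps

  targets↭sources : ∀ {i} (p : Walk Arc i i) → targets p ↭ sources p
  targets↭sources {i} p = drop-∷ (↭-trans (↭-reflexive (rotate p)) (↭-sym (∷↭∷ʳ i (sources p))))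
    where
    rotate : ∀ {i j} (p : Walk Arc i j) → i ∷ targets p ≡ sources p ∷ʳ j
    rotate []                = refl
    rotate (_∷_ {i = i} _ p) = cong (i ∷_) (rotate p)

  length : ∀ {i j} → Walk Arc i j → ℕ
  length []      = 0
  length (_ ∷ p) = suc (length p)

  splitAtSource : ∀ {i j k} (p : Walk Arc j k) → i ∈ sources p →
                  Σ[ p₁ ∈ Walk Arc j i ] Σ[ p₂ ∈ Walk Arc i k ]
                    cost Arc p ≡ cost Arc p₁ + cost Arc p₂ × length p ≡ length p₁ ℕ.+ length p₂
                    × 0 ℕ.< length p₂
  splitAtSource (a ∷ p) (here refl) = [] , a ∷ p , sym (+-identityˡ _) , refl , ℕ.s≤s ℕ.z≤n
  splitAtSource (_∷_ {q = q} a p) (there i∈p) with splitAtSource p i∈p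
  ... | p₁ , p₂ , cost≡ , length≡ , p₂>0 =
    a ∷ p₁ , p₂ , trans (cong (q +_) cost≡) (sym (+-assoc q _ _)) , cong suc length≡ , p₂>0

  data Shape {i k} (p : Walk Arc i k) : Set where
    simple   : Unique (sources p) → Shape p
    withLoop : ∀ {m} (c : Walk Arc m m) (p′ : Walk Arc i k) →
               cost Arc p ≡ cost Arc c + cost Arc p′ → length p ≡ length c ℕ.+ length p′ →
               0 ℕ.< length c → 0 ℕ.< length p′ → Shape p

  shape : ∀ {i k} (p : Walk Arc i k) → Shape p
  shape [] = simple []
  shape (_∷_ {i = i} {q = q} a p) with i ∈? sources p
  ... | yes i∈p with splitAtSource p i∈p
  ...   | p₁ , p₂ , cost≡ , length≡ , p₂>0 =
    withLoop (a ∷ p₁) p₂ (trans (cong (q +_) cost≡) (sym (+-assoc q _ _))) (cong suc length≡) (ℕ.s≤s ℕ.z≤n) p₂>0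
  shape (_∷_ {i = i} {q = q} a p) | no i∉p with shape p
  ... | simple unique = simple (¬Any⇒All¬ _ i∉p ∷ unique)
  ... | withLoop c p′ cost≡ length≡ c>0 _ =
    withLoop c (a ∷ p′)
      (trans (cong (q +_) cost≡) (x∙yz≈y∙xz q (cost Arc c) (cost Arc p′)))
      (trans (cong suc length≡) (sym (ℕ.+-suc (length c) (length p′))))
      c>0 (ℕ.s≤s ℕ.z≤n)

  simpleCyclesSuffice : (∀ i (p : Walk Arc i i) → Unique (sources p) → 0ℚ ≤ cost Arc p) → NoNegativeCycle Arc
  simpleCyclesSuffice simple≥0 i p = go (suc (length p)) p ℕ.≤-refl
    where
    go : ∀ f {i} (p : Walk Arc i i) → length p ℕ.< f → 0ℚ ≤ cost Arc p
    go (suc f) p (ℕ.s≤s p≤f) with shape p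
    ... | simple unique = simple≥0 _ p unique
    ... | withLoop c p′ cost≡ length≡ c>0 p′>0 =
      subst (0ℚ ≤_) (sym cost≡)
        (+-nonneg (go f c  (ℕ.<-≤-trans (subst (length c ℕ.<_)  (sym length≡) (ℕ.m<m+n (length c) p′>0)) p≤f))
                  (go f p′ (ℕ.<-≤-trans (subst (length p′ ℕ.<_) (sym length≡) (ℕ.m<n+m (length p′) c>0)) p≤f)))

module Lookup {E V : Set} {n : ℕ} (entry : E → Maybe (Fin n × V)) where

  at : Fin n → Maybe (Fin n × V) → Maybe V
  at k nothing         = nothing
  at k (just (k′ , v)) = if ⌊ k′ Fin.≟ k ⌋ then just v else nothing

  lookup : Fin n → List E → Maybe V
  lookup k []      = nothing
  lookup k (e ∷ L) = at k (entry e) <∣> lookup k L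

  entry-key : ∀ {e k k′ v v′} → entry e ≡ just (k , v) → entry e ≡ just (k′ , v′) → k ≡ k′
  entry-key eq eq′ with trans (sym eq) eq′
  ... | refl = refl

  lookup-∷-here : ∀ {e k v} L → entry e ≡ just (k , v) → lookup k (e ∷ L) ≡ just v
  lookup-∷-here {k = k} L eq rewrite eq with k Fin.≟ k
  ... | yes _   = refl
  ... | no  k≢k = ⊥-elim (k≢k refl)

  lookup-∷-skip : ∀ {e k} L → (∀ v → entry e ≢ just (k , v)) → lookup k (e ∷ L) ≡ lookup k L
  lookup-∷-skip {e} {k} L ≢k with entry e in eq
  ... | nothing = refl
  ... | just (k′ , v) with k′ Fin.≟ k
  ...   | yes refl = ⊥-elim (≢k v refl)
  ...   | no  _    = refl

  lookup-sound : ∀ {k v} L → lookup k L ≡ just v → Σ[ e ∈ E ] e ∈ L × entry e ≡ just (k , v)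
  lookup-sound {k} (e ∷ L) found with entry e in eq
  ... | nothing = let e′ , e′∈L , eq′ = lookup-sound L found in e′ , there e′∈L , eq′
  ... | just (k′ , v′) with k′ Fin.≟ k
  ...   | yes refl = e , here refl , trans eq (cong (λ v → just (k , v)) (just-injective found))
  ...   | no  _    = let e′ , e′∈L , eq′ = lookup-sound L found in e′ , there e′∈L , eq′

  -- ι need not be injective: uniqueness of keys is derived from distinct nodes of the elements of L.
  module _ {m : ℕ} (node : E → Fin m) (ι : Fin n → Fin m)
           (node-entry : ∀ {e k v} → entry e ≡ just (k , v) → node e ≡ ι k) where

    lookup-absent : ∀ {k} L → ι k ∉ map node L → lookup k L ≡ nothing
    lookup-absent []      _    = refl
    lookup-absent (e ∷ L) ι∉L =
      trans (lookup-∷-skip L (λ v eq → ι∉L (here (sym (node-entry eq))))) (lookup-absent L (ι∉L ∘ there))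

    lookup-complete : ∀ {e k v} L → Unique (map node L) → e ∈ L → entry e ≡ just (k , v) → lookup k L ≡ just v
    lookup-complete (e ∷ L) _                (here refl)  eq = lookup-∷-here L eq
    lookup-complete (e ∷ L) (e-fresh ∷ uniq) (there e′∈L) eq =
      trans (lookup-∷-skip L (λ v eq′ → All.lookup e-fresh (∈-map⁺ node e′∈L)
                                           (trans (node-entry eq′) (sym (node-entry eq)))))
            (lookup-complete L uniq e′∈L eq)

    sum-lookup-∷ : (ψ : Fin n → Maybe V → ℚ) → (∀ k → ψ k nothing ≡ 0ℚ) → ∀ e L → node e ∉ map node L →
                   sum (λ k → ψ k (lookup k (e ∷ L)))
                     ≡ maybe (λ (k , v) → ψ k (just v)) 0ℚ (entry e) + sum (λ k → ψ k (lookup k L))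
    sum-lookup-∷ ψ ψ-nothing e L e-fresh = split refl
      where
      split : ∀ {x} → entry e ≡ x →
              sum (λ k → ψ k (lookup k (e ∷ L)))
                ≡ maybe (λ (k , v) → ψ k (just v)) 0ℚ x + sum (λ k → ψ k (lookup k L))
      split {nothing} eq =
        trans (sum-cong-≗ (λ k → cong (ψ k) (lookup-∷-skip L (λ v eq′ → case trans (sym eq) eq′ of λ ()))))
              (sym (+-identityˡ _))
      split {just (k₀ , v)} eq =
        trans (sum-update _ _ k₀ (λ k k≢k₀ → cong (ψ k) (lookup-∷-skip L (λ v′ eq′ → k≢k₀ (entry-key eq′ eq))))
                                 (trans (cong (ψ k₀) (lookup-absent L (subst (_∉ map node L) (node-entry eq) e-fresh)))
                                        (ψ-nothing k₀)))
              (cong (_+ sum (λ k → ψ k (lookup k L))) (cong (ψ k₀) (lookup-∷-here L eq)))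

-- Votes and weak duality

gain : ∀ {k} → ℚ → (Fin k → ℕ) → Maybe (Fin k) → Maybe (Fin k) → ℚ
gain w r m m′ = contrib w (prefers r m m′) (prefers r m′ m)

ballot : ∀ {k} → ℚ → (Fin k → ℕ) → Maybe (Fin k) → Fin k → ℚ
ballot w r nothing  x = w
ballot w r (just y) x = if ⌊ y Fin.≟ x ⌋ then 0ℚ else (if ⌊ r x ℕ.<? r y ⌋ then w else - w)

gain-refl : ∀ {k} w (r : Fin k → ℕ) m → gain w r m m ≡ 0ℚ
gain-refl w r nothing  = refl
gain-refl w r (just x) with r x ℕ.<? r x
... | yes rx<rx = ⊥-elim (ℕ.<-irrefl refl rx<rx)
... | no  _     = refl

gain-nothing : ∀ {k} w (r : Fin k → ℕ) m → gain w r m nothing ≡ maybe (λ _ → w) 0ℚ m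
gain-nothing w r nothing  = refl
gain-nothing w r (just _) = refl

gain-just : ∀ {k} w (r : Fin k → ℕ) m x → (∀ y → m ≡ just y → r y ≡ r x → y ≡ x) →
            gain w r m (just x) ≡ - ballot w r m x
gain-just w r nothing  x _ = refl
gain-just w r (just y) x r-inj with y Fin.≟ x
... | yes refl = gain-refl w r (just y)
... | no  y≢x with r x ℕ.<? r y | r y ℕ.<? r x
...   | yes x<y | yes y<x = ⊥-elim (ℕ.<-asym x<y y<x)
...   | yes _   | no  _   = refl
...   | no  x≮y | yes _   = sym (neg-involutive w)
...   | no  x≮y | no  y≮x = ⊥-elim (y≢x (r-inj y refl (ℕ.≤-antisym (ℕ.≮⇒≥ x≮y) (ℕ.≮⇒≥ y≮x))))

gain-nothing-nonneg : ∀ {k} w (r : Fin k → ℕ) m {y} → - w ≤ y → (m ≡ nothing → 0ℚ ≤ y) →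
                      0ℚ ≤ gain w r m nothing + y
gain-nothing-nonneg w r nothing  _    0≤y = subst (0ℚ ≤_) (sym (+-identityˡ _)) (0≤y refl)
gain-nothing-nonneg w r (just _) -w≤y _   = ≤-translate w -w≤y (+-inverseˡ w) (+-comm _ w)

module _ (I : BipInstance) where
  open BipInstance I
  open Matching

  voteA≡ballot : ∀ (M : Matching I) a b → voteA I M a b ≡ ballot (wA a) (rankA a) (mA M a) b
  voteA≡ballot M a b with mA M a
  ... | nothing = refl
  ... | just _  = refl

  voteB≡ballot : ∀ (M : Matching I) a b → voteB I M b a ≡ ballot (wB b) (rankB b) (mB M b) a
  voteB≡ballot M a b with mB M b
  ... | nothing = refl
  ... | just _  = refl

  gainA : Matching I → Fin nA → Maybe (Fin nB) → ℚ
  gainA M a = gain (wA a) (rankA a) (mA M a)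

  gainB : Matching I → Fin nB → Maybe (Fin nA) → ℚ
  gainB M b = gain (wB b) (rankB b) (mB M b)

  gain-edge : ∀ M a b → adj a b ≡ true → gainA M a (just b) + gainB M b (just a) ≡ - vote I M a b
  gain-edge M a b ab = begin
    gainA M a (just b) + gainB M b (just a)
      ≡⟨ cong₂ _+_ (gain-just _ _ _ b (λ b′ eq → rankA-inj a b′ b (mA-adj M a b′ eq) ab))
                   (gain-just _ _ _ a (λ a′ eq → rankB-inj b a′ a (mA-adj M a′ b (mB→mA M a′ b eq)) ab)) ⟩
    - ballotA + - ballotB    ≡⟨ neg-distrib-+ ballotA ballotB ⟨
    - (ballotA + ballotB)    ≡⟨ cong -_ (cong₂ _+_ (voteA≡ballot M a b) (voteB≡ballot M a b)) ⟨
    - vote I M a b           ∎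
    where
    open ≡-Reasoning
    ballotA = ballot (wA a) (rankA a) (mA M a) b
    ballotB = ballot (wB b) (rankB b) (mB M b) a

  sum-partnersA≡sum-partnersB : ∀ (N : Matching I) (H : Fin nA → Fin nB → ℚ) →
    sum (λ a → maybe (H a) 0ℚ (mA N a)) ≡ sum (λ b → maybe (λ a → H a b) 0ℚ (mB N b))
  sum-partnersA≡sum-partnersB N H = begin
    sum (λ a → maybe (H a) 0ℚ (mA N a))           ≡⟨ sum-cong-≗ (λ a → row a refl) ⟨
    sum (λ a → sum (λ b → D a b))                 ≡⟨ ∑-comm D ⟩
    sum (λ b → sum (λ a → D a b))                 ≡⟨ sum-cong-≗ (λ b → column b refl) ⟩
    sum (λ b → maybe (λ a → H a b) 0ℚ (mB N b))   ∎
    where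
    open ≡-Reasoning

    D : Fin nA → Fin nB → ℚ
    D a b = maybe (λ b′ → if ⌊ b′ Fin.≟ b ⌋ then H a b else 0ℚ) 0ℚ (mA N a)

    D-off : ∀ a b → mA N a ≢ just b → D a b ≡ 0ℚ
    D-off a b ≢b with mA N a
    ... | nothing = refl
    ... | just b′ with b′ Fin.≟ b
    ...   | yes refl = ⊥-elim (≢b refl)
    ...   | no  _    = refl

    D-on : ∀ {a b} → mA N a ≡ just b → D a b ≡ H a b
    D-on {a} {b} eq rewrite eq with b Fin.≟ b
    ... | yes _   = refl
    ... | no  b≢b = ⊥-elim (b≢b refl)

    row : ∀ a {m} → mA N a ≡ m → sum (D a) ≡ maybe (H a) 0ℚ m
    row a {nothing} eq = sum-zero (λ b → D-off a b (λ eq′ → case trans (sym eq) eq′ of λ ()))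
    row a {just b}  eq =
      trans (sum-single (D a) b (λ b′ b′≢b → D-off a b′ (λ eq′ → b′≢b (just-injective (trans (sym eq′) eq)))))
            (D-on eq)

    column : ∀ b {m} → mB N b ≡ m → sum (λ a → D a b) ≡ maybe (λ a → H a b) 0ℚ m
    column b {nothing} eq = sum-zero (λ a → D-off a b (λ eq′ → case trans (sym eq) (mA→mB N a b eq′) of λ ()))
    column b {just a}  eq =
      trans (sum-single (λ a′ → D a′ b) a
               (λ a′ a′≢a → D-off a′ b (λ eq′ → a′≢a (just-injective (trans (sym (mA→mB N a′ b eq′)) eq)))))
            (D-on (mB→mA N a b eq))

  dualFeasible⇒popular : ∀ M yA yB → DualFeasible I M yA yB → Popular I M
  dualFeasible⇒popular M yA yB (Σy≡0 , edge , unmatchedA , unmatchedB , lowerA , lowerB) M′ =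
    subst (0ℚ ≤_) (sym Δw≡) (+-nonneg (sum-nonneg pairedA-nonneg) (sum-nonneg unpairedB-nonneg))
    where
    open ≡-Reasoning

    gA : Fin nA → ℚ
    gA a = gainA M a (mA M′ a)

    gB : Fin nB → ℚ
    gB b = gainB M b (mB M′ b)

    slackA : Fin nA → ℚ
    slackA a = gA a + yA a

    slackB : Fin nB → ℚ
    slackB b = gB b + yB b

    matchedA : Fin nA → ℚ
    matchedA a = maybe slackB 0ℚ (mA M′ a)

    pairedA : Fin nA → ℚ
    pairedA a = slackA a + matchedA a

    unpairedB : Fin nB → ℚ
    unpairedB b = maybe (λ _ → 0ℚ) (slackB b) (mB M′ b)

    edge-nonneg : ∀ {a b} → adj a b ≡ true → 0ℚ ≤ (gainA M a (just b) + yA a) + (gainB M b (just a) + yB b)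
    edge-nonneg {a} {b} ab = ≤-translate (gainA M a (just b) + gainB M b (just a)) (edge a b ab)
      (trans (cong (vote I M a b +_) (gain-edge M a b ab)) (+-inverseʳ (vote I M a b)))
      (solve 4 (λ u v g h → (u :+ v) :+ (g :+ h) := (g :+ u) :+ (h :+ v))
         refl (yA a) (yB b) (gainA M a (just b)) (gainB M b (just a)))

    pairedA-nonneg : ∀ a → 0ℚ ≤ pairedA a
    pairedA-nonneg a = by refl
      where
      by : ∀ {m} → mA M′ a ≡ m → 0ℚ ≤ slackA a + maybe slackB 0ℚ m
      by {nothing} eq rewrite eq =
        subst (0ℚ ≤_) (sym (+-identityʳ _)) (gain-nothing-nonneg _ _ (mA M a) (lowerA a) (unmatchedA a))
      by {just b}  eq =
        subst₂ (λ m m′ → 0ℚ ≤ (gainA M a m + yA a) + (gainB M b m′ + yB b))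
               (sym eq) (sym (mA→mB M′ a b eq)) (edge-nonneg (mA-adj M′ a b eq))

    unpairedB-nonneg : ∀ b → 0ℚ ≤ unpairedB b
    unpairedB-nonneg b with mB M′ b
    ... | nothing = gain-nothing-nonneg _ _ (mB M b) (lowerB b) (unmatchedB b)
    ... | just _  = ≤-refl

    slackB-split : sum slackB ≡ sum matchedA + sum unpairedB
    slackB-split = begin
      sum slackB                                                       ≡⟨ sum-cong-≗ split ⟩
      sum (λ b → maybe (λ _ → slackB b) 0ℚ (mB M′ b) + unpairedB b)    ≡⟨ ∑-distrib-+ _ unpairedB ⟩
      sum (λ b → maybe (λ _ → slackB b) 0ℚ (mB M′ b)) + sum unpairedB
        ≡⟨ cong (_+ sum unpairedB) (sum-partnersA≡sum-partnersB M′ (λ _ b → slackB b)) ⟨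
      sum matchedA + sum unpairedB                                     ∎
      where
      split : ∀ b → slackB b ≡ maybe (λ _ → slackB b) 0ℚ (mB M′ b) + unpairedB b
      split b with mB M′ b
      ... | nothing = sym (+-identityˡ _)
      ... | just _  = sym (+-identityʳ _)

    Δw≡ : Δw I M M′ ≡ sum pairedA + sum unpairedB
    Δw≡ = begin
      Δw I M M′                                   ≡⟨ cong₂ _+_ (sumFin≡sum gA) (sumFin≡sum gB) ⟩
      sum gA + sum gB                             ≡⟨ +-identityʳ _ ⟨
      (sum gA + sum gB) + 0ℚ                      ≡⟨ cong ((sum gA + sum gB) +_) Σy≡0′ ⟨
      (sum gA + sum gB) + (sum yA + sum yB)       ≡⟨ interchange (sum gA) (sum gB) (sum yA) (sum yB) ⟩
      (sum gA + sum yA) + (sum gB + sum yB)       ≡⟨ cong₂ _+_ (∑-distrib-+ gA yA) (∑-distrib-+ gB yB) ⟨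
      sum slackA + sum slackB                     ≡⟨ cong (sum slackA +_) slackB-split ⟩
      sum slackA + (sum matchedA + sum unpairedB) ≡⟨ +-assoc (sum slackA) (sum matchedA) (sum unpairedB) ⟨
      (sum slackA + sum matchedA) + sum unpairedB ≡⟨ cong (_+ sum unpairedB) (∑-distrib-+ slackA matchedA) ⟨
      sum pairedA + sum unpairedB                 ∎
      where
      Σy≡0′ : sum yA + sum yB ≡ 0ℚ
      Σy≡0′ = trans (sym (cong₂ _+_ (sumFin≡sum yA) (sumFin≡sum yB))) Σy≡0

-- The exchange graph

-- Node suc a is the vertex a ∈ A and node zero stands for "unmatched". With yA a = x (suc a) − x zero and
-- yB b = − yA a for M b = a (0 if b is single), the arcs are the constraints of DualFeasible written as
-- x v ≤ x u + q. Read the other way, a step of a cycle through suc a says whom a is matched to after switching.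
module ExchangeGraph (I : BipInstance) (M : Matching I) where
  open BipInstance I
  open Matching M

  Node : Set
  Node = Fin (suc nA)

  data Arc : Node → Node → ℚ → Set where
    toMatched   : ∀ a b a′ → adj a b ≡ true → mB b ≡ just a′ → Arc (suc a) (suc a′) (- vote I M a b)
    toUnmatched : ∀ a b → adj a b ≡ true → mB b ≡ nothing → Arc (suc a) zero (- vote I M a b)
    stayFree    : ∀ a → mA a ≡ nothing → Arc (suc a) zero 0ℚ
    leaveA      : ∀ a b → mA a ≡ just b → Arc (suc a) zero (wA a)
    leaveB      : ∀ a b → mA a ≡ just b → Arc zero (suc a) (wB b)
    enterFree   : ∀ a → mA a ≡ nothing → Arc zero (suc a) 0ℚ

  emptyOrLeast : ∀ u v → EmptyOrLeast (Arc u v)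
  emptyOrLeast zero zero = inj₁ λ _ ()
  emptyOrLeast zero (suc a) =
    EmptyOrLeast-resp
      ( (λ { (inj₁ (b , eq , refl)) → leaveB a b eq ; (inj₂ (eq , refl)) → enterFree a eq })
      , (λ { (leaveB _ b eq) → inj₁ (b , eq , refl) ; (enterFree _ eq) → inj₂ (eq , refl) }))
      (EmptyOrLeast-⊎ (EmptyOrLeast-∃ λ b → EmptyOrLeast-if (≡-dec Fin._≟_ (mA a) (just b)) (wB b))
                      (EmptyOrLeast-if (≡-dec Fin._≟_ (mA a) nothing) 0ℚ))
  emptyOrLeast (suc a) (suc a′) =
    EmptyOrLeast-resp
      ( (λ { (b , (ab , eq) , refl) → toMatched a b a′ ab eq })
      , (λ { (toMatched _ b _ ab eq) → b , (ab , eq) , refl }))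
      (EmptyOrLeast-∃ λ b →
        EmptyOrLeast-if (adj a b Bool.≟ true ×-dec ≡-dec Fin._≟_ (mB b) (just a′)) (- vote I M a b))
  emptyOrLeast (suc a) zero =
    EmptyOrLeast-resp
      ( (λ { (inj₁ (b , (ab , eq) , refl)) → toUnmatched a b ab eq
           ; (inj₂ (inj₁ (eq , refl)))      → stayFree a eq
           ; (inj₂ (inj₂ (b , eq , refl)))  → leaveA a b eq })
      , (λ { (toUnmatched _ b ab eq) → inj₁ (b , (ab , eq) , refl)
           ; (stayFree _ eq)         → inj₂ (inj₁ (eq , refl))
           ; (leaveA _ b eq)         → inj₂ (inj₂ (b , eq , refl)) }))
      (EmptyOrLeast-⊎
        (EmptyOrLeast-∃ λ b →
          EmptyOrLeast-if (adj a b Bool.≟ true ×-dec ≡-dec Fin._≟_ (mB b) nothing) (- vote I M a b))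
        (EmptyOrLeast-⊎ (EmptyOrLeast-if (≡-dec Fin._≟_ (mA a) nothing) 0ℚ)
                        (EmptyOrLeast-∃ λ b → EmptyOrLeast-if (≡-dec Fin._≟_ (mA a) (just b)) (wA a))))

  potential⇒dualFeasible : Potential Arc →
                           Σ[ yA ∈ (Fin nA → ℚ) ] Σ[ yB ∈ (Fin nB → ℚ) ] DualFeasible I M yA yB
  potential⇒dualFeasible (x , x-ok) = yA , yB , Σy≡0 , edge , unmatchedA , unmatchedB , lowerA , lowerB
    where
    y : Node → ℚ
    y v = x v - x zero

    y-arc : ∀ {u v q} → Arc u v q → y v ≤ y u + q
    y-arc {u} {v} {q} a = ≤-translate (- x zero) (x-ok u v q a) refl
      (solve 3 (λ u q z → (u :+ q) :- z := (u :- z) :+ q) refl (x u) q (x zero))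

    y-zero : y zero ≡ 0ℚ
    y-zero = +-inverseʳ (x zero)

    into-zero : ∀ {u q} → Arc u zero q → 0ℚ ≤ y u + q
    into-zero {u} {q} a = subst (_≤ y u + q) y-zero (y-arc a)

    out-of-zero : ∀ {v q} → Arc zero v q → y v ≤ q
    out-of-zero {q = q} a = subst (_ ≤_) (trans (cong (_+ q) y-zero) (+-identityˡ q)) (y-arc a)

    yA : Fin nA → ℚ
    yA a = y (suc a)

    yB : Fin nB → ℚ
    yB b = maybe (λ a → - yA a) 0ℚ (mB b)

    unmatchedA : ∀ a → mA a ≡ nothing → 0ℚ ≤ yA a
    unmatchedA a eq = subst (0ℚ ≤_) (+-identityʳ (yA a)) (into-zero (stayFree a eq))

    unmatchedB : ∀ b → mB b ≡ nothing → 0ℚ ≤ yB b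
    unmatchedB b eq rewrite eq = ≤-refl

    lowerA : ∀ a → - wA a ≤ yA a
    lowerA a with mA a in eq
    ... | nothing = ≤-trans (neg-antimono-≤ (wA-nonneg a)) (unmatchedA a eq)
    ... | just b  = 0≤p+q⇒-q≤p (into-zero (leaveA a b eq))

    lowerB : ∀ b → - wB b ≤ yB b
    lowerB b with mB b in eq
    ... | nothing = neg-antimono-≤ (wB-nonneg b)
    ... | just a  = neg-antimono-≤ (out-of-zero (leaveB a b (mB→mA a b eq)))

    edge : ∀ a b → adj a b ≡ true → vote I M a b ≤ yA a + yB b
    edge a b ab = by refl
      where
      by : ∀ {m} → mB b ≡ m → vote I M a b ≤ yA a + maybe (λ a → - yA a) 0ℚ m
      by {just a′} eq = p≤r-s⇒s≤r-p {yA a′} {yA a} (y-arc (toMatched a b a′ ab eq))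
      by {nothing} eq = p≤r-s⇒s≤r-p {0ℚ} {yA a} (into-zero (toUnmatched a b ab eq))

    Σy≡0 : sumFin yA + sumFin yB ≡ 0ℚ
    Σy≡0 = begin
      sumFin yA + sumFin yB
        ≡⟨ cong₂ _+_ (sumFin≡sum yA) (sumFin≡sum yB) ⟩
      sum yA + sum yB
        ≡⟨ cong (sum yA +_) (sum-partnersA≡sum-partnersB I M (λ a _ → - yA a)) ⟨
      sum yA + sum (λ a → maybe (λ _ → - yA a) 0ℚ (mA a))
        ≡⟨ ∑-distrib-+ yA _ ⟨
      sum (λ a → yA a + maybe (λ _ → - yA a) 0ℚ (mA a))
        ≡⟨ sum-zero cancel ⟩
      0ℚ ∎
      where
      open ≡-Reasoning
      cancel : ∀ a → yA a + maybe (λ _ → - yA a) 0ℚ (mA a) ≡ 0ℚ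
      cancel a with mA a in eq
      ... | just _  = +-inverseʳ (yA a)
      ... | nothing = trans (+-identityʳ (yA a)) (≤-antisym (out-of-zero (enterFree a eq)) (unmatchedA a eq))

-- Switching along a simple cycle

-- Switching M along a step changes the partner of at most one vertex of A and one of B; changeA and changeB
-- name that vertex and its new partner (nothing: it becomes single).
module CycleToMatching (I : BipInstance) (M : Matching I) where
  open BipInstance I
  open Matching M
  open ExchangeGraph I M

  changeA : Step Arc → Maybe (Fin nA × Maybe (Fin nB))
  changeA (_ , _ , _ , toMatched a b _ _ _) = just (a , just b)
  changeA (_ , _ , _ , toUnmatched a b _ _) = just (a , just b)
  changeA (_ , _ , _ , stayFree a _)        = just (a , nothing)
  changeA (_ , _ , _ , leaveA a _ _)        = just (a , nothing)
  changeA (_ , _ , _ , leaveB _ _ _)        = nothing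
  changeA (_ , _ , _ , enterFree _ _)       = nothing

  changeB : Step Arc → Maybe (Fin nB × Maybe (Fin nA))
  changeB (_ , _ , _ , toMatched a b _ _ _) = just (b , just a)
  changeB (_ , _ , _ , toUnmatched a b _ _) = just (b , just a)
  changeB (_ , _ , _ , stayFree _ _)        = nothing
  changeB (_ , _ , _ , leaveA _ _ _)        = nothing
  changeB (_ , _ , _ , leaveB _ b _)        = just (b , nothing)
  changeB (_ , _ , _ , enterFree _ _)       = nothing

  partnerNode : Fin nB → Node
  partnerNode b = maybe suc zero (mB b)

  changeA-source : ∀ {s a m} → changeA s ≡ just (a , m) → source s ≡ suc a
  changeA-source {_ , _ , _ , toMatched _ _ _ _ _} refl = refl
  changeA-source {_ , _ , _ , toUnmatched _ _ _ _} refl = refl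
  changeA-source {_ , _ , _ , stayFree _ _}        refl = refl
  changeA-source {_ , _ , _ , leaveA _ _ _}        refl = refl

  changeB-target : ∀ {s b m} → changeB s ≡ just (b , m) → target s ≡ partnerNode b
  changeB-target {_ , _ , _ , toMatched _ _ _ _ eq} refl = cong (maybe suc zero) (sym eq)
  changeB-target {_ , _ , _ , toUnmatched _ _ _ eq} refl = cong (maybe suc zero) (sym eq)
  changeB-target {_ , _ , _ , leaveB a b eq}        refl = cong (maybe suc zero) (sym (mA→mB a b eq))

  changeA-adj : ∀ {s a b} → changeA s ≡ just (a , just b) → adj a b ≡ true
  changeA-adj {_ , _ , _ , toMatched _ _ _ ab _} refl = ab
  changeA-adj {_ , _ , _ , toUnmatched _ _ ab _} refl = ab

  changeA⇒changeB : ∀ {s a b} → changeA s ≡ just (a , just b) → changeB s ≡ just (b , just a)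
  changeA⇒changeB {_ , _ , _ , toMatched _ _ _ _ _} refl = refl
  changeA⇒changeB {_ , _ , _ , toUnmatched _ _ _ _} refl = refl

  changeB⇒changeA : ∀ {s a b} → changeB s ≡ just (b , just a) → changeA s ≡ just (a , just b)
  changeB⇒changeA {_ , _ , _ , toMatched _ _ _ _ _} refl = refl
  changeB⇒changeA {_ , _ , _ , toUnmatched _ _ _ _} refl = refl

  leaving : ∀ {s a} → source s ≡ suc a → Σ[ m ∈ Maybe (Fin nB) ] changeA s ≡ just (a , m)
  leaving {_ , _ , _ , toMatched _ b _ _ _} refl = just b  , refl
  leaving {_ , _ , _ , toUnmatched _ b _ _} refl = just b  , refl
  leaving {_ , _ , _ , stayFree _ _}        refl = nothing , refl
  leaving {_ , _ , _ , leaveA _ _ _}        refl = nothing , refl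

  entering : ∀ {s a b} → target s ≡ suc a → mA a ≡ just b → Σ[ m ∈ Maybe (Fin nA) ] changeB s ≡ just (b , m)
  entering {_ , _ , _ , toMatched a′ b′ a _ eq} refl ma with just-injective (trans (sym ma) (mB→mA a b′ eq))
  ... | refl = just a′ , refl
  entering {_ , _ , _ , leaveB a b′ eq}        refl ma with just-injective (trans (sym ma) eq)
  ... | refl = nothing , refl
  entering {_ , _ , _ , enterFree a eq}        refl ma = case trans (sym ma) eq of λ ()

  changeGainA : Step Arc → ℚ
  changeGainA s = maybe (λ (a , m) → gainA I M a m) 0ℚ (changeA s)

  changeGainB : Step Arc → ℚ
  changeGainB s = maybe (λ (b , m) → gainB I M b m) 0ℚ (changeB s)

  label-split : ∀ s → label s ≡ changeGainA s + changeGainB s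
  label-split (_ , _ , _ , toMatched a b _ ab _) = sym (gain-edge I M a b ab)
  label-split (_ , _ , _ , toUnmatched a b ab _) = sym (gain-edge I M a b ab)
  label-split (_ , _ , _ , stayFree a eq)        =
    sym (trans (+-identityʳ _) (trans (gain-nothing (wA a) (rankA a) (mA a)) (cong (maybe _ 0ℚ) eq)))
  label-split (_ , _ , _ , leaveA a _ eq)        =
    sym (trans (+-identityʳ _) (trans (gain-nothing (wA a) (rankA a) (mA a)) (cong (maybe _ 0ℚ) eq)))
  label-split (_ , _ , _ , leaveB a b eq)        =
    sym (trans (+-identityˡ _) (trans (gain-nothing (wB b) (rankB b) (mB b)) (cong (maybe _ 0ℚ) (mA→mB a b eq))))
  label-split (_ , _ , _ , enterFree _ _)        = sym (+-identityˡ 0ℚ)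

  module LA = Lookup changeA
  module LB = Lookup changeB

  switchedGainA : Fin nA → Maybe (Maybe (Fin nB)) → ℚ
  switchedGainA a x = gainA I M a (fromMaybe (mA a) x)

  switchedGainB : Fin nB → Maybe (Maybe (Fin nA)) → ℚ
  switchedGainB b x = gainB I M b (fromMaybe (mB b) x)

  totalGainA : List (Step Arc) → ℚ
  totalGainA L = sum (λ a → switchedGainA a (LA.lookup a L))

  totalGainB : List (Step Arc) → ℚ
  totalGainB L = sum (λ b → switchedGainB b (LB.lookup b L))

  totalGainA-∷ : ∀ s L → source s ∉ map source L → totalGainA (s ∷ L) ≡ changeGainA s + totalGainA L
  totalGainA-∷ = LA.sum-lookup-∷ source suc changeA-source switchedGainA (λ a → gain-refl _ _ (mA a))

  totalGainB-∷ : ∀ s L → target s ∉ map target L → totalGainB (s ∷ L) ≡ changeGainB s + totalGainB L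
  totalGainB-∷ = LB.sum-lookup-∷ target partnerNode changeB-target switchedGainB (λ b → gain-refl _ _ (mB b))

  cost≡totalGain : ∀ {i j} (p : Walk Arc i j) → Unique (sources p) → Unique (targets p) →
                   cost Arc p ≡ totalGainA (steps p) + totalGainB (steps p)
  cost≡totalGain [] _ _ =
    sym (trans (cong₂ _+_ (sum-zero (λ a → gain-refl _ _ (mA a))) (sum-zero (λ b → gain-refl _ _ (mB b))))
               (+-identityʳ 0ℚ))
  cost≡totalGain (_∷_ {i} {j} {q = q} a p) (fresh-s ∷ unique-s) (fresh-t ∷ unique-t) = begin
    q + cost Arc p
      ≡⟨ cong₂ _+_ (label-split s) (cost≡totalGain p unique-s unique-t) ⟩
    (changeGainA s + changeGainB s) + (totalGainA (steps p) + totalGainB (steps p))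
      ≡⟨ interchange (changeGainA s) (changeGainB s) (totalGainA (steps p)) (totalGainB (steps p)) ⟩
    (changeGainA s + totalGainA (steps p)) + (changeGainB s + totalGainB (steps p))
      ≡⟨ cong₂ _+_ (totalGainA-∷ s (steps p) (All¬⇒¬Any fresh-s))
                   (totalGainB-∷ s (steps p) (All¬⇒¬Any fresh-t)) ⟨
    totalGainA (s ∷ steps p) + totalGainB (s ∷ steps p)
      ∎
    where
    open ≡-Reasoning
    s : Step Arc
    s = i , j , q , a

  module Switch {i} (p : Walk Arc i i) (simple : Unique (sources p)) where

    L : List (Step Arc)
    L = steps p

    simple-targets : Unique (targets p)
    simple-targets = ↭ₛ.Unique-resp-↭ (setoid Node) (↭⇒↭ₛ (↭-sym (targets↭sources p))) simple

    targets⊆sources : ∀ {u} → u ∈ targets p → u ∈ sources p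
    targets⊆sources = ∈-resp-↭ (targets↭sources p)

    sources⊆targets : ∀ {u} → u ∈ sources p → u ∈ targets p
    sources⊆targets = ∈-resp-↭ (↭-sym (targets↭sources p))

    newA : Fin nA → Maybe (Maybe (Fin nB))
    newA a = LA.lookup a L

    newB : Fin nB → Maybe (Maybe (Fin nA))
    newB b = LB.lookup b L

    newA-complete : ∀ {s a m} → s ∈ L → changeA s ≡ just (a , m) → newA a ≡ just m
    newA-complete = LA.lookup-complete source suc changeA-source L simple

    newB-complete : ∀ {s b m} → s ∈ L → changeB s ≡ just (b , m) → newB b ≡ just m
    newB-complete = LB.lookup-complete target partnerNode changeB-target L simple-targets

    -- A cycle entering node suc a through the matching edge of a must also leave suc a, and vice versa,
    -- so a and its partner b change partners together.
    keptB : ∀ {a b} → mA a ≡ just b → newA a ≡ nothing → newB b ≡ nothing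
    keptB {a} {b} ma kept = unchanged refl
      where
      unchanged : ∀ {x} → newB b ≡ x → x ≡ nothing
      unchanged {nothing} _     = refl
      unchanged {just _}  found =
        let s , s∈L , eq = LB.lookup-sound L found
            s-enters     = trans (changeB-target eq) (cong (maybe suc zero) (mA→mB a b ma))
            s′ , s′∈L , s′-leaves =
              ∈-map⁻ source (targets⊆sources (subst (_∈ targets p) s-enters (∈-map⁺ target s∈L)))
        in case trans (sym kept) (newA-complete s′∈L (proj₂ (leaving (sym s′-leaves)))) of λ ()

    keptA : ∀ {a b} → mA a ≡ just b → newB b ≡ nothing → newA a ≡ nothing
    keptA {a} {b} ma kept = unchanged refl
      where
      unchanged : ∀ {x} → newA a ≡ x → x ≡ nothing
      unchanged {nothing} _     = refl
      unchanged {just _}  found =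
        let s , s∈L , eq = LA.lookup-sound L found
            s′ , s′∈L , s′-enters =
              ∈-map⁻ target (sources⊆targets (subst (_∈ sources p) (changeA-source eq) (∈-map⁺ source s∈L)))
        in case trans (sym kept) (newB-complete s′∈L (proj₂ (entering (sym s′-enters) ma))) of λ ()

    mA′ : Fin nA → Maybe (Fin nB)
    mA′ a = fromMaybe (mA a) (newA a)

    mB′ : Fin nB → Maybe (Fin nA)
    mB′ b = fromMaybe (mB b) (newB b)

    mA′-adj : ∀ a b → mA′ a ≡ just b → adj a b ≡ true
    mA′-adj a b = by refl
      where
      by : ∀ {x} → newA a ≡ x → fromMaybe (mA a) x ≡ just b → adj a b ≡ true
      by {nothing} _     ma   = mA-adj a b ma
      by {just _}  found refl = changeA-adj (proj₂ (proj₂ (LA.lookup-sound L found)))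

    mA′→mB′ : ∀ a b → mA′ a ≡ just b → mB′ b ≡ just a
    mA′→mB′ a b = by refl
      where
      by : ∀ {x} → newA a ≡ x → fromMaybe (mA a) x ≡ just b → mB′ b ≡ just a
      by {nothing} kept  ma   = trans (cong (fromMaybe (mB b)) (keptB ma kept)) (mA→mB a b ma)
      by {just _}  found refl =
        let s , s∈L , eq = LA.lookup-sound L found in cong (fromMaybe (mB b)) (newB-complete s∈L (changeA⇒changeB eq))

    mB′→mA′ : ∀ a b → mB′ b ≡ just a → mA′ a ≡ just b
    mB′→mA′ a b = by refl
      where
      by : ∀ {x} → newB b ≡ x → fromMaybe (mB b) x ≡ just a → mA′ a ≡ just b
      by {nothing} kept  mb   = trans (cong (fromMaybe (mA a)) (keptA (mB→mA a b mb) kept)) (mB→mA a b mb)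
      by {just _}  found refl =
        let s , s∈L , eq = LB.lookup-sound L found in cong (fromMaybe (mA a)) (newA-complete s∈L (changeB⇒changeA eq))

    M′ : Matching I
    M′ = record { mA = mA′ ; mB = mB′ ; mA-adj = mA′-adj ; mA→mB = mA′→mB′ ; mB→mA = mB′→mA′ }

    Δw≡cost : Δw I M M′ ≡ cost Arc p
    Δw≡cost = begin
      Δw I M M′                 ≡⟨ cong₂ _+_ (sumFin≡sum (λ a → switchedGainA a (newA a)))
                                             (sumFin≡sum (λ b → switchedGainB b (newB b))) ⟩
      totalGainA L + totalGainB L ≡⟨ cost≡totalGain p simple simple-targets ⟨
      cost Arc p                ∎
      where open ≡-Reasoning

  simpleCycle-nonneg : Popular I M → ∀ i (p : Walk Arc i i) → Unique (sources p) → 0ℚ ≤ cost Arc p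
  simpleCycle-nonneg popular i p uniq = subst (0ℚ ≤_) Δw≡cost (popular M′)
    where open Switch p uniq

theorem5 : (I : BipInstance) (M : Matching I) →
    Popular I M ⇔
      (Σ[ yA ∈ (Fin (BipInstance.nA I) → ℚ) ] Σ[ yB ∈ (Fin (BipInstance.nB I) → ℚ) ]
        DualFeasible I M yA yB)
theorem5 I M = mk⇔
  (λ popular → potential⇒dualFeasible (potential Arc emptyOrLeast (simpleCyclesSuffice (simpleCycle-nonneg popular))))
  (λ (yA , yB , dual) → dualFeasible⇒popular I M yA yB dual)
  where
  open ExchangeGraph I M
  open CycleToMatching I M using (simpleCycle-nonneg)
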